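{- For every integer $n\geq 3$, the paired domination number of the Cartesian product $C_5\Box C_n$ satisfies $\gamma_p(C_5\Box C_n)=h(n)$, where $h(n)=\lceil 4n/3\rceil+1$ if $n\equiv 2 \pmod 3$ and $h(n)=\lceil 4n/3\rceil$ otherwise.
   Context: $C_m$ is the cycle on $m$ vertices and $\Box$ is the Cartesian product of graphs. A set $D\subseteq V(G)$ is dominating if every vertex not in $D$ has a neighbor in $D$. A dominating set $D$ is paired if the induced subgraph $G[D]$ has a perfect matching. The paired domination number $\gamma_p(G)$ is the minimum cardinality of a paired dominating set of $G$. -}

module Defs where

open import Data.Nat using (ℕ; zero; suc; _+_; _*_; _≤_; _%_; _/_)
open import Data.Fin using (Fin; toℕ; remQuot)
open import Data.Fin.Subset using (Subset; _∈_; ∣_∣)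
open import Data.Product using (Σ; _×_; _,_; ∃)
open import Data.Sum using (_⊎_)
open import Relation.Binary.PropositionalEquality using (_≡_)

record Graph (N : ℕ) : Set₁ where
  field
    Adj : Fin N → Fin N → Set

open Graph public

CycSucc : (m : ℕ) → Fin m → Fin m → Set
CycSucc m i j = (toℕ j ≡ suc (toℕ i)) ⊎ ((suc (toℕ i) ≡ m) × (toℕ j ≡ 0))

-- The cycle C_m: i ~ j iff one is the cyclic successor of the other.
-- (Used with m ≥ 3, where this is the usual simple cycle.)
Cycle : (m : ℕ) → Graph m
Adj (Cycle m) i j = CycSucc m i j ⊎ CycSucc m j i

-- Cartesian product G □ H on Fin (m * n); vertex v corresponds to
-- the pair remQuot n v = (g , h).
-- (g,h) ~ (g',h') iff (g ~ g' and h = h') or (g = g' and h ~ h').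
_□_ : {m n : ℕ} → Graph m → Graph n → Graph (m * n)
Adj (_□_ {m} {n} G H) u v with remQuot {m} n u | remQuot {m} n v
... | (g , h) | (g' , h') = (Adj G g g' × h ≡ h') ⊎ (g ≡ g' × Adj H h h')

Dominating : {N : ℕ} → Graph N → Subset N → Set
Dominating {N} G D = (v : Fin N) → v ∈ D ⊎ (Σ (Fin N) λ u → u ∈ D × Adj G v u)

-- The induced subgraph G[D] has a perfect matching: a partner map M on D
-- with M v ∈ D, v ~ M v, and M (M v) = v (each vertex of D matched to
-- exactly one adjacent vertex of D; fixed points are excluded since the
-- graph is loopless, i.e. Adj v v never holds for our graphs).
HasPerfectMatching : {N : ℕ} → Graph N → Subset N → Set
HasPerfectMatching {N} G D =
  Σ (Fin N → Fin N) λ M →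
    (v : Fin N) → v ∈ D → (M v ∈ D) × Adj G v (M v) × (M (M v) ≡ v)

PairedDominating : {N : ℕ} → Graph N → Subset N → Set
PairedDominating G D = Dominating G D × HasPerfectMatching G D

IsPairedDominationNumber : {N : ℕ} → Graph N → ℕ → Set
IsPairedDominationNumber {N} G k =
  (Σ (Subset N) λ D → PairedDominating G D × ∣ D ∣ ≡ k) ×
  ((D : Subset N) → PairedDominating G D → k ≤ ∣ D ∣)

ceil3 : ℕ → ℕ
ceil3 a = (a + 2) / 3

h : ℕ → ℕ
h n with n % 3
... | 2 = ceil3 (4 * n) + 1
... | _ = ceil3 (4 * n)

module Submission where

-- Let D be a paired dominating set of C₅ □ Cₙ, d c the number of its vertices in
-- column c, and r c the number of matched pairs joining columns c and c + 1.
-- Every vertex has a neighbour in D (its partner or a dominator); summed over the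
-- five vertices of a column this gives d (c - 1) + d (c + 1) + 2 d c ≥ 5.  Sorting
-- the vertices of column c by the direction of their partner gives
-- d c = r (c - 1) + r c + 2 k c, with k c the pairs inside the column.  From these
-- constraints alone, a potential Φ (d c) (d (c + 1)) (parity of r c) makes
-- 3 d (c + 1) - 4 telescope around the cycle, so 3 ∣D∣ ≥ 4 n; as ∣D∣ is even, it is
-- at least h n, the least even number ≥ 4 n / 3.  Conversely, the columns
-- {0} {0} {2,3} repeated, the two row-0 vertices matched to each other, and closed
-- by {2,3} or by {0,1} {2,3} when n ≡ 1 or 2 (mod 3), form a paired dominating set
-- of size h n.

open import Defs
open import Data.Nat using (ℕ; _≥_)
open import Data.Nat using (zero; suc; _+_; _*_; _≤_; _<_; _%_; _≤ᵇ_; _≤?_; z≤n; s≤s; parity; allUpTo?)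
import Data.Nat.Properties as ℕ
open import Data.Nat.DivMod using (+-distrib-/-∣ˡ)
open import Data.Nat.Divisibility using (divides)
open import Data.Nat.Tactic.RingSolver using (solve-∀)
open import Data.Parity.Base using (Parity; 0ℙ; 1ℙ)
open import Data.Bool using (Bool; true; false; _∧_; if_then_else_)
import Data.Bool.Properties as Bool
open import Data.Fin using (Fin; zero; suc; toℕ; fromℕ; fromℕ<; inject₁; combine; remQuot; _↑ˡ_; _↑ʳ_)
open import Data.Fin.Patterns using (0F; 1F; 2F; 3F)
import Data.Fin.Properties as Fin
open import Data.Fin.Permutation using (permutation)
open import Data.Fin.Subset using (Subset; ∣_∣; _∈_)
open import Data.Vec using ([]; _∷_; lookup; tabulate)
open import Data.Vec.Properties using (lookup∘tabulate; []=⇒lookup; lookup⇒[]=)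
open import Data.Product using (Σ; _×_; _,_; proj₁; proj₂)
open import Data.Sum using (_⊎_; inj₁; inj₂)
import Data.Sum as Sum
open import Data.Empty using (⊥-elim)
open import Function using (_∘_; id; _⇔_; mk⇔)
open import Relation.Nullary using (Dec; ¬_; yes; no; does)
open import Relation.Nullary.Decidable
  using (map′; dec-true; does-⇔; toWitness; _×-dec_; _⊎-dec_; _→-dec_)
open import Relation.Binary using (DecidableEquality)
open import Relation.Binary.PropositionalEquality
open import Algebra.Properties.Semiring.Sum ℕ.+-*-semiring
  using (sum-syntax; sum-cong-≗; ∑-distrib-+; ∑-comm; ∑-permute; *-distribˡ-sum)

ceil3[4[3+m]]≡4+ceil3[4m] : ∀ m → ceil3 (4 * (3 + m)) ≡ 4 + ceil3 (4 * m)
ceil3[4[3+m]]≡4+ceil3[4m] m =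
  trans (cong ceil3 (ℕ.*-distribˡ-+ 4 3 m)) (+-distrib-/-∣ˡ (4 * m + 2) {3} (divides 4 refl))

-- (3 + m) % 3 reduces to m % 3, so both sides split on the same case.
h[3+m]≡4+h[m] : ∀ m → h (3 + m) ≡ 4 + h m
h[3+m]≡4+h[m] m with m % 3
... | 0 = ceil3[4[3+m]]≡4+ceil3[4m] m
... | 1 = ceil3[4[3+m]]≡4+ceil3[4m] m
... | 2 = cong (_+ 1) (ceil3[4[3+m]]≡4+ceil3[4m] m)
... | suc (suc (suc _)) = ceil3[4[3+m]]≡4+ceil3[4m] m

h≤even : ∀ n m → n * 4 ≤ m * 6 → h n ≤ m * 2
h≤even 0 m _ = z≤n
h≤even 1 (suc m) _ = s≤s (s≤s z≤n)
h≤even 2 (suc (suc m)) _ = s≤s (s≤s (s≤s (s≤s z≤n)))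
h≤even 2 1 (s≤s (s≤s (s≤s (s≤s (s≤s (s≤s ()))))))
h≤even (suc (suc (suc n))) (suc (suc m)) 4[3+n]≤6[2+m]
  rewrite h[3+m]≡4+h[m] n = ℕ.+-monoʳ-≤ 4 (h≤even n m (ℕ.+-cancelˡ-≤ 12 _ _ 4[3+n]≤6[2+m]))
h≤even (suc (suc (suc n))) 1 (s≤s (s≤s (s≤s (s≤s (s≤s (s≤s ()))))))

𝟙 : Bool → ℕ
𝟙 true = 1
𝟙 false = 0

∣p∣≡∑𝟙 : ∀ {N} (p : Subset N) → ∣ p ∣ ≡ ∑[ i < N ] 𝟙 (lookup p i)
∣p∣≡∑𝟙 [] = refl
∣p∣≡∑𝟙 (true ∷ p) = cong suc (∣p∣≡∑𝟙 p)
∣p∣≡∑𝟙 (false ∷ p) = ∣p∣≡∑𝟙 p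

∑-const : ∀ n k → ∑[ i < n ] k ≡ n * k
∑-const zero k = refl
∑-const (suc n) k = cong (k +_) (∑-const n k)

∑-mono-≤ : ∀ {n} {f g : Fin n → ℕ} → (∀ i → f i ≤ g i) → ∑[ i < n ] f i ≤ ∑[ i < n ] g i
∑-mono-≤ {zero} _ = z≤n
∑-mono-≤ {suc n} {f} {g} f≤g =
  ℕ.+-mono-≤ (f≤g zero) (∑-mono-≤ {f = f ∘ suc} {g ∘ suc} (f≤g ∘ suc))

∑-↑ : ∀ m n (f : Fin (m + n) → ℕ) →
      ∑[ i < m + n ] f i ≡ ∑[ i < m ] f (i ↑ˡ n) + ∑[ j < n ] f (m ↑ʳ j)
∑-↑ zero n f = refl
∑-↑ (suc m) n f = trans (cong (f zero +_) (∑-↑ m n (f ∘ suc))) (sym (ℕ.+-assoc (f zero) _ _))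

∑-combine : ∀ m n (f : Fin (m * n) → ℕ) →
            ∑[ v < m * n ] f v ≡ ∑[ i < m ] ∑[ j < n ] f (combine i j)
∑-combine zero n f = refl
∑-combine (suc m) n f =
  trans (∑-↑ n (m * n) f) (cong (∑[ j < n ] f (j ↑ˡ (m * n)) +_) (∑-combine m n (f ∘ (n ↑ʳ_))))

-- Cycles

next : ∀ {m} → Fin m → Fin m
next {suc m} i with suc (toℕ i) ℕ.<? suc m
... | yes i+1<m = fromℕ< i+1<m
... | no _ = zero

prev : ∀ {m} → Fin m → Fin m
prev {suc m} zero = fromℕ m
prev {suc m} (suc i) = inject₁ i

next-succ : ∀ {m} (i : Fin m) → CycSucc m i (next i)
next-succ {suc m} i with suc (toℕ i) ℕ.<? suc m
... | yes i+1<m = inj₁ (Fin.toℕ-fromℕ< i+1<m)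
... | no i+1≮m = inj₂ (ℕ.≤-antisym (Fin.toℕ<n i) (ℕ.≮⇒≥ i+1≮m) , refl)

prev-succ : ∀ {m} (i : Fin m) → CycSucc m (prev i) i
prev-succ {suc m} zero = inj₂ (cong suc (Fin.toℕ-fromℕ m) , refl)
prev-succ {suc m} (suc i) = inj₁ (cong suc (sym (Fin.toℕ-inject₁ i)))

succ⇒next : ∀ {m} {i j : Fin m} → CycSucc m i j → j ≡ next i
succ⇒next {m} {i} {j} i→j with i→j | next-succ i
... | inj₁ e | inj₁ e′ = Fin.toℕ-injective (trans e (sym e′))
... | inj₁ e | inj₂ (i+1≡m , _) = ⊥-elim (ℕ.<-irrefl (trans e i+1≡m) (Fin.toℕ<n j))
... | inj₂ (i+1≡m , _) | inj₁ e′ = ⊥-elim (ℕ.<-irrefl (trans e′ i+1≡m) (Fin.toℕ<n (next i)))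
... | inj₂ (_ , e) | inj₂ (_ , e′) = Fin.toℕ-injective (trans e (sym e′))

succ⇒prev : ∀ {m} {i j : Fin m} → CycSucc m i j → i ≡ prev j
succ⇒prev {suc m} {i} {suc j} (inj₁ e) =
  Fin.toℕ-injective (trans (ℕ.suc-injective (sym e)) (sym (Fin.toℕ-inject₁ j)))
succ⇒prev {suc m} {i} {zero} (inj₂ (e , _)) =
  Fin.toℕ-injective (trans (ℕ.suc-injective e) (sym (Fin.toℕ-fromℕ m)))

next-prev : ∀ {m} (i : Fin m) → next (prev i) ≡ i
next-prev i = sym (succ⇒next (prev-succ i))

prev-next : ∀ {m} (i : Fin m) → prev (next i) ≡ i
prev-next i = sym (succ⇒prev (next-succ i))

no-loop : ∀ {m} → 2 ≤ m → {i : Fin m} → ¬ CycSucc m i i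
no-loop _ (inj₁ e) = ℕ.1+n≢n (sym e)
no-loop (s≤s (s≤s _)) (inj₂ (e , i≡0)) with () ← trans (sym e) (cong suc i≡0)

no-2-cycle : ∀ {m} → 3 ≤ m → {i j : Fin m} → CycSucc m i j → ¬ CycSucc m j i
no-2-cycle _ (inj₁ e) (inj₁ e′) = ℕ.m≢1+n+m _ (trans e′ (cong suc e))
no-2-cycle (s≤s (s≤s (s≤s _))) (inj₁ e) (inj₂ (e′ , i≡0))
  with () ← trans (sym e′) (cong suc (trans e (cong suc i≡0)))
no-2-cycle (s≤s (s≤s (s≤s _))) (inj₂ (e , j≡0)) (inj₁ e′)
  with () ← trans (sym e) (cong suc (trans e′ (cong suc j≡0)))
no-2-cycle (s≤s (s≤s (s≤s _))) (inj₂ (e , _)) (inj₂ (_ , i≡0))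
  with () ← trans (sym e) (cong suc i≡0)

data Orientation : Set where
  forward backward : Orientation

reverse : Orientation → Orientation
reverse forward = backward
reverse backward = forward

_≟ₒ_ : DecidableEquality Orientation
forward ≟ₒ forward = yes refl
forward ≟ₒ backward = no λ ()
backward ≟ₒ forward = no λ ()
backward ≟ₒ backward = yes refl

move : ∀ {m} → Orientation → Fin m → Fin m
move forward = next
move backward = prev

move-reverse : ∀ {m} o (i : Fin m) → move (reverse o) (move o i) ≡ i
move-reverse forward = prev-next
move-reverse backward = next-prev

move-adjacent : ∀ {m} o (i : Fin m) → Adj (Cycle m) i (move o i)
move-adjacent forward i = inj₁ (next-succ i)
move-adjacent backward i = inj₂ (prev-succ i)

adjacent⇒move : ∀ {m} {i j : Fin m} → Adj (Cycle m) i j → Σ Orientation λ o → j ≡ move o i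
adjacent⇒move (inj₁ i→j) = forward , succ⇒next i→j
adjacent⇒move (inj₂ j→i) = backward , succ⇒prev j→i

move-≢ : ∀ {m} → 2 ≤ m → ∀ o (i : Fin m) → move o i ≢ i
move-≢ m≥2 forward i e = no-loop m≥2 (subst (CycSucc _ i) e (next-succ i))
move-≢ m≥2 backward i e = no-loop m≥2 (subst (λ k → CycSucc _ k i) e (prev-succ i))

move-injective : ∀ {m} → 3 ≤ m → ∀ {o o′} (i : Fin m) → move o i ≡ move o′ i → o ≡ o′
move-injective _ {forward} {forward} _ _ = refl
move-injective _ {backward} {backward} _ _ = refl
move-injective m≥3 {forward} {backward} i e =
  ⊥-elim (no-2-cycle m≥3 (next-succ i) (subst (λ k → CycSucc _ k i) (sym e) (prev-succ i)))
move-injective m≥3 {backward} {forward} i e =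
  ⊥-elim (no-2-cycle m≥3 (next-succ i) (subst (λ k → CycSucc _ k i) e (prev-succ i)))

∑-move : ∀ {m} o (f : Fin m → ℕ) → ∑[ i < m ] f (move o i) ≡ ∑[ i < m ] f i
∑-move forward f = sym (∑-permute f (permutation next prev next-prev prev-next))
∑-move backward f = sym (∑-permute f (permutation prev next prev-next next-prev))

-- The grid C₅ □ Cₙ

data Dir : Set where
  vert horiz : Orientation → Dir

_≟ᵈ_ : DecidableEquality Dir
vert o ≟ᵈ vert o′ = map′ (cong vert) (λ { refl → refl }) (o ≟ₒ o′)
vert _ ≟ᵈ horiz _ = no λ ()
horiz _ ≟ᵈ vert _ = no λ ()
horiz o ≟ᵈ horiz o′ = map′ (cong horiz) (λ { refl → refl }) (o ≟ₒ o′)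

opposite : Dir → Dir
opposite (vert o) = vert (reverse o)
opposite (horiz o) = horiz (reverse o)

opposite-involutive : ∀ d → opposite (opposite d) ≡ d
opposite-involutive (vert forward) = refl
opposite-involutive (vert backward) = refl
opposite-involutive (horiz forward) = refl
opposite-involutive (horiz backward) = refl

rowStep colStep : ∀ {m} → Dir → Fin m → Fin m
rowStep (vert o) i = move o i
rowStep (horiz _) i = i
colStep (vert _) i = i
colStep (horiz o) i = move o i

∑Dir : (Dir → ℕ) → ℕ
∑Dir f = f (vert forward) + f (vert backward) + f (horiz forward) + f (horiz backward)

∑Dir-cong : ∀ {f g : Dir → ℕ} → (∀ d → f d ≡ g d) → ∑Dir f ≡ ∑Dir g
∑Dir-cong f≡g = cong₂ _+_ (cong₂ _+_ (cong₂ _+_ (f≡g _) (f≡g _)) (f≡g _)) (f≡g _)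

≤∑Dir : ∀ f d → f d ≤ ∑Dir f
≤∑Dir f = pick
  where
  a = f (vert forward)
  b = f (vert backward)
  c = f (horiz forward)
  e = f (horiz backward)
  pick : ∀ d → f d ≤ a + b + c + e
  pick (vert forward) =
    ℕ.≤-trans (ℕ.≤-trans (ℕ.m≤m+n a b) (ℕ.m≤m+n (a + b) c)) (ℕ.m≤m+n (a + b + c) e)
  pick (vert backward) =
    ℕ.≤-trans (ℕ.≤-trans (ℕ.m≤n+m b a) (ℕ.m≤m+n (a + b) c)) (ℕ.m≤m+n (a + b + c) e)
  pick (horiz forward) = ℕ.≤-trans (ℕ.m≤n+m c (a + b)) (ℕ.m≤m+n (a + b + c) e)
  pick (horiz backward) = ℕ.m≤n+m e (a + b + c)

∑-∑Dir : ∀ {m} (f : Fin m → Dir → ℕ) → ∑[ i < m ] ∑Dir (f i) ≡ ∑Dir λ d → ∑[ i < m ] f i d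
∑-∑Dir {m} f =
  trans (∑-distrib-+ (λ i → a i + b i + c i) e)
        (cong (_+ ∑[ i < m ] e i) (trans (∑-distrib-+ (λ i → a i + b i) c)
                                         (cong (_+ ∑[ i < m ] c i) (∑-distrib-+ a b))))
  where
  a = λ i → f i (vert forward)
  b = λ i → f i (vert backward)
  c = λ i → f i (horiz forward)
  e = λ i → f i (horiz backward)

module Grid (n : ℕ) where

  G : Graph (5 * n)
  G = Cycle 5 □ Cycle n

  Cell : Set
  Cell = Fin 5 × Fin n

  vtx : Cell → Fin (5 * n)
  vtx (r , c) = combine r c

  cell : Fin (5 * n) → Cell
  cell = remQuot {5} n

  cell-vtx : ∀ p → cell (vtx p) ≡ p
  cell-vtx (r , c) = Fin.remQuot-combine r c

  vtx-cell : ∀ v → vtx (cell v) ≡ v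
  vtx-cell = Fin.combine-remQuot {5} n

  vtx-injective : ∀ {p q} → vtx p ≡ vtx q → p ≡ q
  vtx-injective {p} {q} e = trans (sym (cell-vtx p)) (trans (cong cell e) (cell-vtx q))

  -- Adj G u v unfolds definitionally to cell u ~ cell v.
  _~_ : Cell → Cell → Set
  (r , c) ~ (r′ , c′) = (Adj (Cycle 5) r r′ × c ≡ c′) ⊎ (r ≡ r′ × Adj (Cycle n) c c′)

  shift : Dir → Cell → Cell
  shift d (r , c) = rowStep d r , colStep d c

  shift-opposite : ∀ d p → shift (opposite d) (shift d p) ≡ p
  shift-opposite (vert o) (r , c) = cong (_, c) (move-reverse o r)
  shift-opposite (horiz o) (r , c) = cong (r ,_) (move-reverse o c)

  shift-injective : 3 ≤ n → ∀ {d d′} p → shift d p ≡ shift d′ p → d ≡ d′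
  shift-injective _ {vert _} {vert _} (r , _) e =
    cong vert (move-injective (s≤s (s≤s (s≤s z≤n))) r (cong proj₁ e))
  shift-injective _ {vert o} {horiz _} (r , _) e = ⊥-elim (move-≢ (s≤s (s≤s z≤n)) o r (cong proj₁ e))
  shift-injective n≥3 {horiz o} {vert _} (_ , c) e = ⊥-elim (move-≢ (ℕ.<⇒≤ n≥3) o c (cong proj₂ e))
  shift-injective n≥3 {horiz _} {horiz _} (_ , c) e = cong horiz (move-injective n≥3 c (cong proj₂ e))

  shift-adjacent : ∀ d v → Adj G v (vtx (shift d (cell v)))
  shift-adjacent d v = subst (cell v ~_) (sym (cell-vtx (shift d (cell v)))) (~shift d (cell v))
    where
    ~shift : ∀ d p → p ~ shift d p
    ~shift (vert o) (r , c) = inj₁ (move-adjacent o r , refl)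
    ~shift (horiz o) (r , c) = inj₂ (refl , move-adjacent o c)

  adjacent⇒shift : ∀ {u v} → Adj G u v → Σ Dir λ d → cell v ≡ shift d (cell u)
  adjacent⇒shift (inj₁ (r~r′ , c≡c′))
    with o , e ← adjacent⇒move r~r′ = vert o , cong₂ _,_ e (sym c≡c′)
  adjacent⇒shift (inj₂ (r≡r′ , c~c′))
    with o , e ← adjacent⇒move c~c′ = horiz o , cong₂ _,_ (sym r≡r′) e

  ∣D∣≡∑columns : (D : Subset (5 * n)) →
                 ∣ D ∣ ≡ ∑[ c < n ] ∑[ r < 5 ] 𝟙 (lookup D (vtx (r , c)))
  ∣D∣≡∑columns D =
    trans (∣p∣≡∑𝟙 D) (trans (∑-combine 5 n _) (∑-comm (λ r c → 𝟙 (lookup D (vtx (r , c))))))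

  cellSet : (Cell → Bool) → Subset (5 * n)
  cellSet P = tabulate (P ∘ cell)

  lookup-cellSet : ∀ P p → lookup (cellSet P) (vtx p) ≡ P p
  lookup-cellSet P p = trans (lookup∘tabulate (P ∘ cell) (vtx p)) (cong P (cell-vtx p))

  ∈cellSet : ∀ P {p} → P p ≡ true → vtx p ∈ cellSet P
  ∈cellSet P {p} e = lookup⇒[]= (vtx p) (cellSet P) (trans (lookup-cellSet P p) e)

  ∈cellSet⁻ : ∀ P {v} → v ∈ cellSet P → P (cell v) ≡ true
  ∈cellSet⁻ P {v} v∈ = trans (sym (lookup∘tabulate (P ∘ cell) v)) ([]=⇒lookup v∈)

  cellSet-dominating : ∀ P → (∀ p → P p ≡ true ⊎ Σ Dir λ d → P (shift d p) ≡ true) →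
                       Dominating G (cellSet P)
  cellSet-dominating P local v with local (cell v)
  ... | inj₁ e = inj₁ (subst (_∈ cellSet P) (vtx-cell v) (∈cellSet P e))
  ... | inj₂ (d , e) = inj₂ (vtx (shift d (cell v)) , ∈cellSet P e , shift-adjacent d v)

  cellSet-matching : ∀ P (δ : Cell → Dir) →
                     (∀ p → P p ≡ true →
                        P (shift (δ p) p) ≡ true × δ (shift (δ p) p) ≡ opposite (δ p)) →
                     HasPerfectMatching G (cellSet P)
  cellSet-matching P δ local = partner , partner-spec
    where
    partner : Fin (5 * n) → Fin (5 * n)
    partner v = vtx (shift (δ (cell v)) (cell v))

    partner-spec : ∀ v → v ∈ cellSet P →
                   partner v ∈ cellSet P × Adj G v (partner v) × partner (partner v) ≡ v
    partner-spec v v∈ = ∈cellSet P (proj₁ local-p) , shift-adjacent d v , involutive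
      where
      open ≡-Reasoning
      p = cell v
      d = δ p
      q = shift d p
      local-p = local p (∈cellSet⁻ P v∈)
      involutive : partner (partner v) ≡ v
      involutive = begin
        vtx (shift (δ (cell (vtx q))) (cell (vtx q)))
                                        ≡⟨ cong (λ q′ → vtx (shift (δ q′) q′)) (cell-vtx q) ⟩
        vtx (shift (δ q) q)             ≡⟨ cong (λ d′ → vtx (shift d′ q)) (proj₂ local-p) ⟩
        vtx (shift (opposite d) q)      ≡⟨ cong vtx (shift-opposite d p) ⟩
        vtx p                           ≡⟨ vtx-cell v ⟩
        v                               ∎

-- Lower bound

paired⇒total : ∀ {N} {G : Graph N} {D : Subset N} → PairedDominating G D →
               ∀ v → Σ (Fin N) λ u → u ∈ D × Adj G v u
paired⇒total (dominating , M , matched) v with dominating v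
... | inj₁ v∈D = M v , proj₁ (matched v v∈D) , proj₁ (proj₂ (matched v v∈D))
... | inj₂ u = u

telescope : ∀ {n} a (f g : Fin n → ℕ) → (∀ c → a + g c ≤ f (next c) + g (next c)) →
            n * a ≤ ∑[ c < n ] f c
telescope {n} a f g step = ℕ.+-cancelʳ-≤ (∑[ c < n ] g c) (n * a) _ (begin
  n * a + ∑[ c < n ] g c                ≡⟨ cong (_+ ∑[ c < n ] g c) (∑-const n a) ⟨
  ∑[ c < n ] a + ∑[ c < n ] g c         ≡⟨ ∑-distrib-+ (λ _ → a) g ⟨
  ∑[ c < n ] (a + g c)                  ≤⟨ ∑-mono-≤ step ⟩
  ∑[ c < n ] (f (next c) + g (next c))  ≡⟨ ∑-move forward (λ c → f c + g c) ⟩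
  ∑[ c < n ] (f c + g c)                ≡⟨ ∑-distrib-+ f g ⟩
  ∑[ c < n ] f c + ∑[ c < n ] g c       ∎)
  where open ℕ.≤-Reasoning

-- Φ a b p is the potential of two consecutive columns holding a and b vertices of D
-- with p the parity of the number of pairs matched across them; in Φ-Step the middle
-- of three columns holds b = ρ + ρ′ + 2 k, split into ρ and ρ′ pairs across its two
-- sides and k pairs inside it.  The table was found by a longest-path computation
-- over these finitely many configurations.
Φ : ℕ → ℕ → Parity → ℕ
Φ 0 b 0ℙ = if b ≤ᵇ 2 then 4 else 8
Φ 0 _ 1ℙ = 0
Φ 1 _ 0ℙ = 4
Φ 1 b 1ℙ = if b ≤ᵇ 1 then 3 else 5
Φ 2 _ 0ℙ = 2
Φ 2 _ 1ℙ = 3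
Φ 3 _ 0ℙ = 0
Φ 3 _ 1ℙ = 3
Φ _ _ _ = 0

Φ-Step : ℕ → ℕ → ℕ → ℕ → ℕ → Set
Φ-Step a c ρ ρ′ k = b ≤ 5 → ρ′ ≤ c → 5 ≤ a + c + 2 * b →
                    4 + Φ a b (parity ρ) ≤ 3 * b + Φ b c (parity ρ′)
  where b = ρ + ρ′ + 2 * k

Φ-step : ∀ {a} → a < 6 → ∀ {c} → c < 6 → ∀ {ρ} → ρ < 6 → ∀ {ρ′} → ρ′ < 6 →
         ∀ {k} → k < 3 → Φ-Step a c ρ ρ′ k
Φ-step = toWitness {a? = allUpTo? (λ a → allUpTo? (λ c → allUpTo? (λ ρ → allUpTo? (λ ρ′ →
  allUpTo? (Φ-step? a c ρ ρ′) 3) 6) 6) 6) 6} _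
  where
  Φ-step? : ∀ a c ρ ρ′ k → Dec (Φ-Step a c ρ ρ′ k)
  Φ-step? a c ρ ρ′ k = _ ≤? 5 →-dec (ρ′ ≤? c →-dec (5 ≤? _ →-dec (_ ≤? _)))

discharging : ∀ {n} (d r k : Fin n → ℕ) →
              (∀ c → d c ≤ 5) →
              (∀ c → 5 ≤ d (prev c) + d (next c) + 2 * d c) →
              (∀ c → d c ≡ r (prev c) + r c + 2 * k c) →
              n * 4 ≤ 3 * ∑[ c < n ] d c
discharging {n} d r k d≤5 dominated split =
  subst (n * 4 ≤_) (sym (*-distribˡ-sum 3 d)) (telescope 4 (λ c → 3 * d c) g step)
  where
  g : Fin n → ℕ
  g c = Φ (d c) (d (next c)) (parity (r c))

  split-next : ∀ c → d (next c) ≡ r c + r (next c) + 2 * k (next c)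
  split-next c = trans (split (next c)) (cong (λ c′ → r c′ + r (next c) + 2 * k (next c)) (prev-next c))

  step : ∀ c → 4 + g c ≤ 3 * d (next c) + g (next c)
  step c = subst (λ b → 4 + Φ (d c) b (parity (r c)) ≤ 3 * b + Φ b (d y) (parity (r x)))
                 (sym (split-next c))
                 (Φ-step (s≤s (d≤5 c)) (s≤s (d≤5 y)) ρ<6 ρ′<6 k<3 b≤5 ρ′≤dy dominated′)
    where
    x = next c
    y = next x
    b≤5 : r c + r x + 2 * k x ≤ 5
    b≤5 = subst (_≤ 5) (split-next c) (d≤5 x)
    ρ+ρ′≤5 : r c + r x ≤ 5
    ρ+ρ′≤5 = ℕ.m+n≤o⇒m≤o (r c + r x) b≤5
    ρ<6 : r c < 6
    ρ<6 = s≤s (ℕ.m+n≤o⇒m≤o (r c) ρ+ρ′≤5)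
    ρ′<6 : r x < 6
    ρ′<6 = s≤s (ℕ.m+n≤o⇒n≤o (r c) ρ+ρ′≤5)
    k<3 : k x < 3
    k<3 = ℕ.*-cancelˡ-< 2 (k x) 3 (s≤s (ℕ.m+n≤o⇒n≤o (r c + r x) b≤5))
    ρ′≤dy : r x ≤ d y
    ρ′≤dy = subst (r x ≤_) (sym (split-next x))
                  (ℕ.m+n≤o⇒m≤o (r x) (ℕ.m≤m+n (r x + r y) (2 * k y)))
    dominated′ : 5 ≤ d c + d y + 2 * (r c + r x + 2 * k x)
    dominated′ = subst₂ (λ c′ b → 5 ≤ d c′ + d y + 2 * b) (prev-next c) (split-next c) (dominated x)

∑-twice : ∀ {n} (d r k : Fin n → ℕ) → (∀ c → d c ≡ r (prev c) + r c + 2 * k c) →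
          ∑[ c < n ] d c ≡ (∑[ c < n ] r c + ∑[ c < n ] k c) * 2
∑-twice {n} d r k split = begin
  ∑[ c < n ] d c
    ≡⟨ sum-cong-≗ split ⟩
  ∑[ c < n ] (r (prev c) + r c + 2 * k c)
    ≡⟨ ∑-distrib-+ (λ c → r (prev c) + r c) (λ c → 2 * k c) ⟩
  ∑[ c < n ] (r (prev c) + r c) + ∑[ c < n ] (2 * k c)
    ≡⟨ cong₂ _+_ (∑-distrib-+ (r ∘ prev) r) (sym (*-distribˡ-sum 2 k)) ⟩
  ∑[ c < n ] r (prev c) + R + 2 * K
    ≡⟨ cong (λ s → s + R + 2 * K) (∑-move backward r) ⟩
  R + R + 2 * K
    ≡⟨ regroup R K ⟩
  (R + K) * 2
    ∎
  where
  open ≡-Reasoning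
  R = ∑[ c < n ] r c
  K = ∑[ c < n ] k c
  regroup : ∀ x y → x + x + 2 * y ≡ (x + y) * 2
  regroup = solve-∀

module LowerBound {n} (n≥3 : 3 ≤ n) (D : Subset (5 * n))
                   (pd : PairedDominating (Cycle 5 □ Cycle n) D) where
  open Grid n

  partner : Fin (5 * n) → Fin (5 * n)
  partner = proj₁ (proj₂ pd)

  partner-spec : ∀ v → v ∈ D → partner v ∈ D × Adj G v (partner v) × partner (partner v) ≡ v
  partner-spec = proj₂ (proj₂ pd)

  inD : Cell → Bool
  inD p = lookup D (vtx p)

  inD⇒∈ : ∀ p → inD p ≡ true → vtx p ∈ D
  inD⇒∈ p = lookup⇒[]= (vtx p) D

  matched : Dir → Cell → Bool
  matched d p = inD p ∧ does (partner (vtx p) Fin.≟ vtx (shift d p))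

  matched⁻ : ∀ d p → matched d p ≡ true → inD p ≡ true × partner (vtx p) ≡ vtx (shift d p)
  matched⁻ d p _ with inD p | partner (vtx p) Fin.≟ vtx (shift d p)
  ... | true | yes towards = refl , towards

  matched⁺ : ∀ d p → inD p ≡ true → partner (vtx p) ≡ vtx (shift d p) → matched d p ≡ true
  matched⁺ d p p∈D towards = cong₂ _∧_ p∈D (dec-true (_ Fin.≟ _) towards)

  partner-direction : ∀ p → inD p ≡ true → Σ Dir λ d → partner (vtx p) ≡ vtx (shift d p)
  partner-direction p p∈D
    with d , e ← adjacent⇒shift (proj₁ (proj₂ (partner-spec (vtx p) (inD⇒∈ p p∈D)))) =
    d , (begin
      partner (vtx p)               ≡⟨ vtx-cell _ ⟨
      vtx (cell (partner (vtx p)))  ≡⟨ cong vtx e ⟩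
      vtx (shift d (cell (vtx p)))  ≡⟨ cong (vtx ∘ shift d) (cell-vtx p) ⟩
      vtx (shift d p)               ∎)
    where open ≡-Reasoning

  inD-split : ∀ p → 𝟙 (inD p) ≡ ∑Dir λ d → 𝟙 (matched d p)
  inD-split p = split (inD p) refl
    where
    split : ∀ b → inD p ≡ b →
            𝟙 b ≡ ∑Dir λ d → 𝟙 (b ∧ does (partner (vtx p) Fin.≟ vtx (shift d p)))
    split false _ = refl
    split true p∈D with d₀ , e ← partner-direction p p∈D =
      trans (one-hot d₀) (∑Dir-cong λ d → cong 𝟙 (does-⇔ (towards d) (d₀ ≟ᵈ d) (_ Fin.≟ _)))
      where
      one-hot : ∀ d₀ → 1 ≡ ∑Dir λ d → 𝟙 (does (d₀ ≟ᵈ d))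
      one-hot (vert forward) = refl
      one-hot (vert backward) = refl
      one-hot (horiz forward) = refl
      one-hot (horiz backward) = refl
      towards : ∀ d → (d₀ ≡ d) ⇔ (partner (vtx p) ≡ vtx (shift d p))
      towards d = mk⇔ (λ { refl → e })
                      (λ e′ → shift-injective n≥3 p (vtx-injective (trans (sym e) e′)))

  matched⇒ : ∀ d p → matched d p ≡ true → matched (opposite d) (shift d p) ≡ true
  matched⇒ d p e = matched⁺ (opposite d) q q∈D (begin
    partner (vtx q)             ≡⟨ cong partner towards ⟨
    partner (partner (vtx p))   ≡⟨ proj₂ (proj₂ (partner-spec (vtx p) (inD⇒∈ p p∈D))) ⟩
    vtx p                       ≡⟨ cong vtx (shift-opposite d p) ⟨
    vtx (shift (opposite d) q)  ∎)
    where
    open ≡-Reasoning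
    q = shift d p
    p∈D = proj₁ (matched⁻ d p e)
    towards = proj₂ (matched⁻ d p e)
    q∈D : inD q ≡ true
    q∈D = trans (cong (lookup D) (sym towards))
                ([]=⇒lookup (proj₁ (partner-spec (vtx p) (inD⇒∈ p p∈D))))

  matched-opposite : ∀ d p → matched (opposite d) (shift d p) ≡ matched d p
  matched-opposite d p = Bool.⇔→≡ (mk⇔ back (matched⇒ d p))
    where
    back : matched (opposite d) (shift d p) ≡ true → matched d p ≡ true
    back e = subst₂ (λ d′ p′ → matched d′ p′ ≡ true) (opposite-involutive d) (shift-opposite d p)
                    (matched⇒ (opposite d) (shift d p) e)

  neighbour-in-D : ∀ p → Σ Dir λ d → inD (shift d p) ≡ true
  neighbour-in-D p with u , u∈D , adj ← paired⇒total pd (vtx p) with d , e ← adjacent⇒shift adj =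
    d , trans (cong (lookup D) vtx-shift≡u) ([]=⇒lookup u∈D)
    where
    vtx-shift≡u : vtx (shift d p) ≡ u
    vtx-shift≡u = trans (cong (vtx ∘ shift d) (sym (cell-vtx p))) (trans (cong vtx (sym e)) (vtx-cell u))

  occupancy : Fin n → ℕ
  occupancy c = ∑[ r < 5 ] 𝟙 (inD (r , c))

  matchings : Dir → Fin n → ℕ
  matchings d c = ∑[ r < 5 ] 𝟙 (matched d (r , c))

  pairsAcross pairsWithin : Fin n → ℕ
  pairsAcross = matchings (horiz forward)
  pairsWithin = matchings (vert forward)

  regroup : ∀ x y z → x + x + y + z ≡ z + y + 2 * x
  regroup = solve-∀

  occupancy-split : ∀ c → occupancy c ≡ pairsAcross (prev c) + pairsAcross c + 2 * pairsWithin c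
  occupancy-split c = begin
    occupancy c
      ≡⟨ sum-cong-≗ (λ r → inD-split (r , c)) ⟩
    ∑[ r < 5 ] ∑Dir (λ d → 𝟙 (matched d (r , c)))
      ≡⟨ ∑-∑Dir (λ r d → 𝟙 (matched d (r , c))) ⟩
    pairsWithin c + matchings (vert backward) c + pairsAcross c + matchings (horiz backward) c
      ≡⟨ cong₂ (λ s w → pairsWithin c + s + pairsAcross c + w) down≡up left≡right ⟩
    pairsWithin c + pairsWithin c + pairsAcross c + pairsAcross (prev c)
      ≡⟨ regroup (pairsWithin c) (pairsAcross c) (pairsAcross (prev c)) ⟩
    pairsAcross (prev c) + pairsAcross c + 2 * pairsWithin c ∎
    where
    open ≡-Reasoning
    down≡up : matchings (vert backward) c ≡ pairsWithin c
    down≡up = trans (sym (∑-move forward λ r → 𝟙 (matched (vert backward) (r , c))))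
                    (sum-cong-≗ λ r → cong 𝟙 (matched-opposite (vert forward) (r , c)))
    left≡right : matchings (horiz backward) c ≡ pairsAcross (prev c)
    left≡right = sum-cong-≗ λ r → cong 𝟙 (trans
      (cong (λ c′ → matched (horiz backward) (r , c′)) (sym (next-prev c)))
      (matched-opposite (horiz forward) (r , prev c)))

  occupancy-dominating : ∀ c → 5 ≤ occupancy (prev c) + occupancy (next c) + 2 * occupancy c
  occupancy-dominating c = begin
    5
      ≤⟨ ∑-mono-≤ {f = λ _ → 1} seen ⟩
    ∑[ r < 5 ] ∑Dir (λ d → 𝟙 (inD (shift d (r , c))))
      ≡⟨ ∑-∑Dir (λ r d → 𝟙 (inD (shift d (r , c)))) ⟩
    ∑[ r < 5 ] 𝟙 (inD (next r , c)) + ∑[ r < 5 ] 𝟙 (inD (prev r , c))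
      + occupancy (next c) + occupancy (prev c)
      ≡⟨ cong₂ (λ s t → s + t + occupancy (next c) + occupancy (prev c))
               (∑-move forward λ r → 𝟙 (inD (r , c))) (∑-move backward λ r → 𝟙 (inD (r , c))) ⟩
    occupancy c + occupancy c + occupancy (next c) + occupancy (prev c)
      ≡⟨ regroup (occupancy c) (occupancy (next c)) (occupancy (prev c)) ⟩
    occupancy (prev c) + occupancy (next c) + 2 * occupancy c ∎
    where
    open ℕ.≤-Reasoning
    seen : ∀ r → 1 ≤ ∑Dir λ d → 𝟙 (inD (shift d (r , c)))
    seen r with d , e ← neighbour-in-D (r , c) =
      ℕ.≤-trans (ℕ.≤-reflexive (cong 𝟙 (sym e))) (≤∑Dir (λ d → 𝟙 (inD (shift d (r , c)))) d)

  occupancy≤5 : ∀ c → occupancy c ≤ 5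
  occupancy≤5 c = ∑-mono-≤ {g = λ _ → 1} (λ r → 𝟙≤1 (inD (r , c)))
    where
    𝟙≤1 : ∀ b → 𝟙 b ≤ 1
    𝟙≤1 true = ℕ.≤-refl
    𝟙≤1 false = z≤n

  lower-bound : h n ≤ ∣ D ∣
  lower-bound = begin
    h n                     ≤⟨ h≤even n pairs (subst (n * 4 ≤_) 3∑≡pairs*6 4n≤3∑) ⟩
    pairs * 2               ≡⟨ ∑-twice occupancy pairsAcross pairsWithin occupancy-split ⟨
    ∑[ c < n ] occupancy c  ≡⟨ ∣D∣≡∑columns D ⟨
    ∣ D ∣                   ∎
    where
    open ℕ.≤-Reasoning
    pairs = ∑[ c < n ] pairsAcross c + ∑[ c < n ] pairsWithin c
    4n≤3∑ : n * 4 ≤ 3 * ∑[ c < n ] occupancy c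
    4n≤3∑ = discharging occupancy pairsAcross pairsWithin occupancy≤5 occupancy-dominating occupancy-split
    times6 : ∀ x → 3 * (x * 2) ≡ x * 6
    times6 = solve-∀
    3∑≡pairs*6 : 3 * ∑[ c < n ] occupancy c ≡ pairs * 6
    3∑≡pairs*6 =
      trans (cong (3 *_) (∑-twice occupancy pairsAcross pairsWithin occupancy-split)) (times6 pairs)

-- Upper bound

-- top⁺ and top⁻ hold row 0 only, matched with the next and the previous column;
-- pairᵢⱼ holds rows i and j, matched with each other.  pair₂₃′ is a copy of pair₂₃
-- that may follow pair₂₃ but only precede top⁺, so that mayPrecede never allows three
-- consecutive columns on rows 2 and 3 (the middle one would leave row 0 undominated).
data ColumnType : Set where
  top⁺ top⁻ pair₀₁ pair₂₃ pair₂₃′ : ColumnType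

rows : ColumnType → Fin 5 → Bool
rows top⁺ 0F = true
rows top⁻ 0F = true
rows pair₀₁ 0F = true
rows pair₀₁ 1F = true
rows pair₂₃ 2F = true
rows pair₂₃ 3F = true
rows pair₂₃′ 2F = true
rows pair₂₃′ 3F = true
rows _ _ = false

partnerDir : ColumnType → Fin 5 → Dir
partnerDir top⁺ _ = horiz forward
partnerDir top⁻ _ = horiz backward
partnerDir pair₀₁ 0F = vert forward
partnerDir pair₂₃ 2F = vert forward
partnerDir pair₂₃′ 2F = vert forward
partnerDir _ _ = vert backward

mayPrecede : ColumnType → ColumnType → Bool
mayPrecede top⁺ top⁻ = true
mayPrecede top⁻ pair₂₃ = true
mayPrecede pair₂₃ top⁺ = true
mayPrecede pair₂₃ pair₀₁ = true
mayPrecede pair₂₃ pair₂₃′ = true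
mayPrecede pair₀₁ pair₂₃′ = true
mayPrecede pair₂₃′ top⁺ = true
mayPrecede _ _ = false

layout : ℕ → ℕ → ColumnType
layout (suc (suc (suc m))) 0 = top⁺
layout (suc (suc (suc m))) 1 = top⁻
layout (suc (suc (suc m))) 2 = pair₂₃
layout (suc (suc (suc m))) (suc (suc (suc i))) = layout m i
layout 2 0 = pair₀₁
layout _ _ = pair₂₃′

layout-size : ∀ n → ∑[ c < n ] ∑[ r < 5 ] 𝟙 (rows (layout n (toℕ c)) r) ≡ h n
layout-size 0 = refl
layout-size 1 = refl
layout-size 2 = refl
layout-size (suc (suc (suc m))) = trans (cong (4 +_) (layout-size m)) (sym (h[3+m]≡4+h[m] m))

layout-consecutive : ∀ n i → suc i < n → mayPrecede (layout n i) (layout n (suc i)) ≡ true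
layout-consecutive (suc (suc (suc m))) 0 _ = refl
layout-consecutive (suc (suc (suc m))) 1 _ = refl
layout-consecutive 3 2 (s≤s (s≤s (s≤s ())))
layout-consecutive 4 2 _ = refl
layout-consecutive 5 2 _ = refl
layout-consecutive (suc (suc (suc (suc (suc (suc m)))))) 2 _ = refl
layout-consecutive (suc (suc (suc m))) (suc (suc (suc i))) (s≤s (s≤s (s≤s i+1<m))) =
  layout-consecutive m i i+1<m
layout-consecutive 2 0 _ = refl
layout-consecutive 2 (suc _) (s≤s (s≤s ()))
layout-consecutive 1 _ (s≤s ())

layout-last : ∀ m → mayPrecede (layout (suc m) m) top⁺ ≡ true
layout-last 0 = refl
layout-last 1 = refl
layout-last 2 = refl
layout-last (suc (suc (suc m))) = layout-last m

layout-cyclic : ∀ {n} → 3 ≤ n → (c : Fin n) →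
                mayPrecede (layout n (toℕ c)) (layout n (toℕ (next c))) ≡ true
layout-cyclic {n} n≥3 c = step n (toℕ c) (toℕ (next c)) n≥3 (Fin.toℕ<n (next c)) (next-succ c)
  where
  step : ∀ n i j → 3 ≤ n → j < n → (j ≡ suc i) ⊎ (suc i ≡ n × j ≡ 0) →
         mayPrecede (layout n i) (layout n j) ≡ true
  step n i .(suc i) _ i+1<n (inj₁ refl) = layout-consecutive n i i+1<n
  step .(suc (suc (suc i))) (suc (suc i)) .0 _ _ (inj₂ (refl , refl)) = layout-last (suc (suc i))
  step .1 0 .0 (s≤s ()) _ (inj₂ (refl , refl))
  step .2 1 .0 (s≤s (s≤s ())) _ (inj₂ (refl , refl))

View : Set
View = ColumnType × ColumnType × ColumnType

typeTowards : Dir → View → ColumnType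
typeTowards (vert _) (_ , t , _) = t
typeTowards (horiz forward) (_ , _ , t₊) = t₊
typeTowards (horiz backward) (t₋ , _ , _) = t₋

occupied : View → Dir → Fin 5 → Bool
occupied w d r = rows (typeTowards d w) (rowStep d r)

LocallyDominated : View → Fin 5 → Set
LocallyDominated w@(_ , t , _) r = rows t r ≡ true ⊎ Σ Dir λ d → occupied w d r ≡ true

LocallyMatched : View → Fin 5 → Set
LocallyMatched w@(_ , t , _) r =
  rows t r ≡ true → occupied w d r ≡ true × partnerDir (typeTowards d w) (rowStep d r) ≡ opposite d
  where d = partnerDir t r

allColumnTypes? : {P : ColumnType → Set} → (∀ t → Dec (P t)) → Dec (∀ t → P t)
allColumnTypes? P? =
  map′ (λ (a , b , c , d , e) →
          λ { top⁺ → a ; top⁻ → b ; pair₀₁ → c ; pair₂₃ → d ; pair₂₃′ → e })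
       (λ all → all top⁺ , all top⁻ , all pair₀₁ , all pair₂₃ , all pair₂₃′)
       (P? top⁺ ×-dec P? top⁻ ×-dec P? pair₀₁ ×-dec P? pair₂₃ ×-dec P? pair₂₃′)

anyDir? : {P : Dir → Set} → (∀ d → Dec (P d)) → Dec (Σ Dir P)
anyDir? P? =
  map′ (λ { (inj₁ p) → _ , p ; (inj₂ (inj₁ p)) → _ , p
          ; (inj₂ (inj₂ (inj₁ p))) → _ , p ; (inj₂ (inj₂ (inj₂ p))) → _ , p })
       (λ { (vert forward , p) → inj₁ p ; (vert backward , p) → inj₂ (inj₁ p)
          ; (horiz forward , p) → inj₂ (inj₂ (inj₁ p))
          ; (horiz backward , p) → inj₂ (inj₂ (inj₂ p)) })
       (P? (vert forward) ⊎-dec P? (vert backward) ⊎-dec P? (horiz forward) ⊎-dec P? (horiz backward))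

locallyDominated? : ∀ w r → Dec (LocallyDominated w r)
locallyDominated? w@(_ , t , _) r = rows t r Bool.≟ true ⊎-dec anyDir? λ d → occupied w d r Bool.≟ true

locallyMatched? : ∀ w r → Dec (LocallyMatched w r)
locallyMatched? w@(_ , t , _) r =
  rows t r Bool.≟ true →-dec
    (occupied w d r Bool.≟ true ×-dec partnerDir (typeTowards d w) (rowStep d r) ≟ᵈ opposite d)
  where d = partnerDir t r

local-conditions : ∀ t₋ t t₊ → mayPrecede t₋ t ≡ true → mayPrecede t t₊ ≡ true →
                   ∀ r → LocallyDominated (t₋ , t , t₊) r × LocallyMatched (t₋ , t , t₊) r
local-conditions = toWitness {a? = allColumnTypes? λ t₋ → allColumnTypes? λ t → allColumnTypes? λ t₊ →
  mayPrecede t₋ t Bool.≟ true →-dec (mayPrecede t t₊ Bool.≟ true →-dec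
    Fin.all? λ r → locallyDominated? (t₋ , t , t₊) r ×-dec locallyMatched? (t₋ , t , t₊) r)} _

module UpperBound {n} (n≥3 : 3 ≤ n) where
  open Grid n

  τ : Fin n → ColumnType
  τ c = layout n (toℕ c)

  view : Fin n → View
  view c = τ (prev c) , τ c , τ (next c)

  τ-colStep : ∀ d c → τ (colStep d c) ≡ typeTowards d (view c)
  τ-colStep (vert _) _ = refl
  τ-colStep (horiz forward) _ = refl
  τ-colStep (horiz backward) _ = refl

  local : ∀ r c → LocallyDominated (view c) r × LocallyMatched (view c) r
  local r c = local-conditions _ _ _ prev-c→c (layout-cyclic n≥3 c) r
    where
    prev-c→c : mayPrecede (τ (prev c)) (τ c) ≡ true
    prev-c→c =
      subst (λ c′ → mayPrecede (τ (prev c)) (τ c′) ≡ true) (next-prev c) (layout-cyclic n≥3 (prev c))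

  member : Cell → Bool
  member (r , c) = rows (τ c) r

  δ : Cell → Dir
  δ (r , c) = partnerDir (τ c) r

  D : Subset (5 * n)
  D = cellSet member

  dominating : Dominating G D
  dominating = cellSet-dominating member λ (r , c) →
    Sum.map id (λ (d , e) → d , subst (λ t → rows t (rowStep d r) ≡ true) (sym (τ-colStep d c)) e)
            (proj₁ (local r c))

  matching : HasPerfectMatching G D
  matching = cellSet-matching member δ λ (r , c) r∈τc →
    let d = δ (r , c)
        (occupied-d , opposite-back) = proj₂ (local r c) r∈τc
    in subst (λ t → rows t (rowStep d r) ≡ true) (sym (τ-colStep d c)) occupied-d ,
       subst (λ t → partnerDir t (rowStep d r) ≡ opposite d) (sym (τ-colStep d c)) opposite-back

  size : ∣ D ∣ ≡ h n
  size = trans (∣D∣≡∑columns D)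
               (trans (sum-cong-≗ λ c → sum-cong-≗ λ r → cong 𝟙 (lookup-cellSet member (r , c)))
                      (layout-size n))

theorem4p5 : (n : ℕ) → n ≥ 3 → IsPairedDominationNumber (Cycle 5 □ Cycle n) (h n)
theorem4p5 n n≥3 = (D , (dominating , matching) , size) , LowerBound.lower-bound n≥3
  where open UpperBound n≥3
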